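{- Let $(G',f')$ be a monotone parallel dynamical system on vertex set $\{1,\dots,n\}$ with global map $\Phi(X)=[f'_1(X),\dots,f'_n(X)]$, and suppose it has a (not necessarily monotone) sequentialization $(G,f,\pi)$ with $\pi=12\cdots n$, i.e. $F_{\pi}=F_n\circ\cdots\circ F_1=\Phi$. For $1\le i\le n$ let $A_i=\{F_{i-1}\circ\cdots\circ F_1(X):X\in\mathbb{F}_2^n\}\subseteq\mathbb{F}_2^n$ (so $A_1=\mathbb{F}_2^n$). Then $(G',f')$ can be sequentialized as a monotone SDS with respect to $\pi$ (i.e. there exist a graph $\hat G$ on $\{1,\dots,n\}$ and monotone local functions $\hat f$ with $\hat F_{\pi}=\Phi$) if and only if, for every $1\le i\le n$, $f_i$ is monotone on $A_i$, meaning that $Y\mapsto f_i(Y)$ (evaluated on the coordinates of $Y$ at $i$ and its $G$-neighbours) is a monotone map $A_i\to\mathbb{F}_2$ with respect to the order of $\mathbb{F}_2^n$.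
   Context: States are elements of $\mathbb{F}_2^n$, $\mathbb{F}_2=\{0,1\}$, ordered componentwise with $0<1$. A parallel dynamical system $(G',f')$: a graph $G'$ on $\{1,\dots,n\}$ and local functions $f'_i$ of the states of $i$ and its $G'$-neighbours, with global map $X\mapsto[f'_1(X),\dots,f'_n(X)]$ (all vertices updated simultaneously); it is monotone if all $f'_i$ are monotone. An SDS $(G,f,\pi)$: a graph $G$ on $\{1,\dots,n\}$, local functions $f_i$ of the states of $i$ and its $G$-neighbours, inflations $F_i:\mathbb{F}_2^n\to\mathbb{F}_2^n$ replacing coordinate $i$ by the value of $f_i$ and fixing the other coordinates, and for a permutation $\pi=\pi_1\cdots\pi_n$, $F_\pi=F_{\pi_n}\circ\cdots\circ F_{\pi_1}$; it is monotone if all $f_i$ are monotone. An SDS $(G,f,\pi)$ with the same vertex set is a sequentialization of $(G',f')$ if $F_\pi$ equals the global map of $(G',f')$. -}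

module Defs where

open import Data.Nat using (ℕ)
open import Data.Bool using (Bool; true; false; _≤_)
open import Data.Fin using (Fin; toℕ; _≟_)
open import Data.List using (List; []; _∷_; take; allFin)
open import Data.Sum using (_⊎_)
open import Data.Product using (Σ; _×_; _,_)
open import Relation.Binary.PropositionalEquality using (_≡_)
open import Relation.Nullary using (¬_; yes; no)

-- States: elements of F₂ⁿ, as functions Fin n → Bool
-- (vertex k of {1..n} is Fin index k-1; false = 0 < true = 1).
State : ℕ → Set
State n = Fin n → Bool

_≤ₛ_ : ∀ {n} → State n → State n → Set
X ≤ₛ Y = ∀ j → X j ≤ Y j

record Graph (n : ℕ) : Set where
  field
    adj    : Fin n → Fin n → Bool
    sym    : ∀ i j → adj i j ≡ adj j i
    irrefl : ∀ i → adj i i ≡ false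
open Graph public

LocalFunctions : ∀ {n} → Graph n → Set
LocalFunctions {n} G =
  Σ (Fin n → State n → Bool) λ f →
    ∀ i (X Y : State n) →
      (∀ j → (j ≡ i ⊎ adj G i j ≡ true) → X j ≡ Y j) → f i X ≡ f i Y

MonotoneMap : ∀ {n} → (State n → Bool) → Set
MonotoneMap g = ∀ X Y → X ≤ₛ Y → g X ≤ g Y

MonotoneFamily : ∀ {n} → (Fin n → State n → Bool) → Set
MonotoneFamily f = ∀ i → MonotoneMap (f i)

parallelMap : ∀ {n} → (Fin n → State n → Bool) → State n → State n
parallelMap f X i = f i X

inflation : ∀ {n} → (Fin n → State n → Bool) → Fin n → State n → State n
inflation f i X j with j ≟ i
... | yes _ = f i X
... | no  _ = X j

runSeq : ∀ {n} → (Fin n → State n → Bool) → List (Fin n) → State n → State n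
runSeq f []       X = X
runSeq f (i ∷ is) X = runSeq f is (inflation f i X)

sdsMap : ∀ {n} → (Fin n → State n → Bool) → State n → State n
sdsMap {n} f = runSeq f (allFin n)

-- F_{i-1} ∘ ⋯ ∘ F_1 (for vertex i, i.e. Fin index toℕ i inflations applied).
prefixMap : ∀ {n} → (Fin n → State n → Bool) → Fin n → State n → State n
prefixMap {n} f i = runSeq f (take (toℕ i) (allFin n))

_≗ₛ_ : ∀ {n} → (State n → State n) → (State n → State n) → Set
F ≗ₛ H = ∀ X j → F X j ≡ H X j

-- g is monotone on A_i = { prefixMap f i X : X ∈ F₂ⁿ }.
MonotoneOnImage : ∀ {n} → (State n → State n) → (State n → Bool) → Set
MonotoneOnImage P g = ∀ X Y → P X ≤ₛ P Y → g (P X) ≤ g (P Y)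

-- A sequential map F_π determines all its intermediate states: coordinate j of
-- F_{i-1} ∘ ⋯ ∘ F_1 (X) is F_π(X)_j for j < i and X_j otherwise. Hence two
-- local families have the same F_π iff each pair f_i, f̂_i agrees on A_i
-- (⇒ by reading off coordinates, ⇐ by induction along π). So a monotone
-- sequentialization exists iff every f_i restricted to A_i has a monotone
-- extension to F₂ⁿ, and that happens iff f_i is monotone on A_i: take the upper
-- closure f̂_i(Y) = ∃ Z ∈ A_i. Z ≤ Y ∧ f_i(Z), local for the complete graph.
module Submission where

open import Defs hiding (sym)
open import Data.Nat using (ℕ; zero; suc; _<_; s≤s) renaming (_≤_ to _≤ℕ_)
open import Data.Nat.Properties using (≤-refl; <⇒≤; <-irrefl; ≤∧≢⇒<; ≮⇒≥; _<?_)
import Data.Nat.Properties as ℕ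
open import Data.Bool using (Bool; true; false; T; b≤b) renaming (_≤_ to _≤ᵇ_)
open import Data.Bool.Properties using (≤-minimum; ≤-antisym) renaming (≤-trans to ≤ᵇ-trans; _≤?_ to _≤ᵇ?_)
open import Data.Fin using (Fin; toℕ; _≟_; fromℕ<)
open import Data.Fin.Properties using (toℕ-fromℕ<; toℕ-injective; toℕ<n; all?)
open import Data.Fin.Subset using (Subset)
open import Data.Fin.Subset.Properties using (anySubset?)
open import Data.List using ([]; _∷_; _∷ʳ_; take; allFin)
open import Data.List.Properties using (take-suc-tabulate; take-all; length-tabulate)
open import Data.Vec using (lookup; tabulate)
open import Data.Vec.Properties using (lookup∘tabulate)
open import Data.Sum using (_⊎_; inj₁; inj₂)
open import Data.Product using (Σ; _×_; proj₁; _,_)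
open import Function using (id)
open import Function.Bundles using (_⇔_; mk⇔)
open import Relation.Binary.PropositionalEquality
open import Relation.Nullary using (Dec; yes; no; does; contradiction)
open import Relation.Nullary.Decidable using (_×-dec_; T?)

private
  variable
    n : ℕ

Family : ℕ → Set
Family n = Fin n → State n → Bool

infix 4 _≈ₛ_

_≈ₛ_ : State n → State n → Set
X ≈ₛ Y = ∀ j → X j ≡ Y j

RespectsPointwise : (State n → Bool) → Set
RespectsPointwise g = ∀ X Y → X ≈ₛ Y → g X ≡ g Y

does-mono : ∀ {a b} {P : Set a} {Q : Set b} → (P → Q) → (p : Dec P) (q : Dec Q) → does p ≤ᵇ does q
does-mono P⇒Q (yes p) (yes q) = b≤b
does-mono P⇒Q (yes p) (no ¬q) = contradiction (P⇒Q p) ¬q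
does-mono P⇒Q (no ¬p) q       = ≤-minimum (does q)

T-mono : ∀ {a b} → a ≤ᵇ b → T a → T b
T-mono b≤b t = t

≈ₛ⇒≤ₛ : {X Y : State n} → X ≈ₛ Y → X ≤ₛ Y
≈ₛ⇒≤ₛ X≈Y j = subst (_ ≤ᵇ_) (X≈Y j) b≤b

≤ₛ-trans : {X Y Z : State n} → X ≤ₛ Y → Y ≤ₛ Z → X ≤ₛ Z
≤ₛ-trans X≤Y Y≤Z j = ≤ᵇ-trans (X≤Y j) (Y≤Z j)

_≤ₛ?_ : (X Y : State n) → Dec (X ≤ₛ Y)
X ≤ₛ? Y = all? (λ j → X j ≤ᵇ? Y j)

monotone⇒respectsPointwise : {g : State n → Bool} → MonotoneMap g → RespectsPointwise g
monotone⇒respectsPointwise mono X Y X≈Y =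
  ≤-antisym (mono X Y (≈ₛ⇒≤ₛ X≈Y)) (mono Y X (≈ₛ⇒≤ₛ (λ j → sym (X≈Y j))))

local⇒respectsPointwise : {G : Graph n} → (f : LocalFunctions G) → ∀ i → RespectsPointwise (proj₁ f i)
local⇒respectsPointwise (f , local) i X Y X≈Y = local i X Y (λ j _ → X≈Y j)

completeGraph : ∀ n → Graph n
completeGraph n = record { adj = distinct ; sym = distinct-sym ; irrefl = distinct-irrefl }
  where
  distinct : Fin n → Fin n → Bool
  distinct i j with i ≟ j
  ... | yes _ = false
  ... | no  _ = true

  distinct-sym : ∀ i j → distinct i j ≡ distinct j i
  distinct-sym i j with i ≟ j | j ≟ i
  ... | yes _   | yes _   = refl
  ... | no  _   | no  _   = refl
  ... | yes i≡j | no  j≢i = contradiction (sym i≡j) j≢i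
  ... | no  i≢j | yes j≡i = contradiction (sym j≡i) i≢j

  distinct-irrefl : ∀ i → distinct i i ≡ false
  distinct-irrefl i with i ≟ i
  ... | yes _   = refl
  ... | no  i≢i = contradiction refl i≢i

respectsPointwise⇒localOnComplete : (g : Family n) →
  (∀ i → RespectsPointwise (g i)) → LocalFunctions (completeGraph n)
respectsPointwise⇒localOnComplete g resp = g , λ i X Y agree → resp i X Y (λ j → agree j (nearby i j))
  where
  nearby : ∀ i j → j ≡ i ⊎ adj (completeGraph n) i j ≡ true
  nearby i j with j ≟ i | i ≟ j
  ... | yes j≡i | _       = inj₁ j≡i
  ... | no  _   | no  _   = inj₂ refl
  ... | no  j≢i | yes i≡j = contradiction (sym i≡j) j≢i

inflation-self : ∀ (f : Family n) i X → inflation f i X i ≡ f i X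
inflation-self f i X with i ≟ i
... | yes _   = refl
... | no  i≢i = contradiction refl i≢i

inflation-other : ∀ (f : Family n) {i j} X → j ≢ i → inflation f i X j ≡ X j
inflation-other f {i} {j} X j≢i with j ≟ i
... | yes j≡i = contradiction j≡i j≢i
... | no  _   = refl

inflation-cong : ∀ (f g : Family n) i {X Y} →
  X ≈ₛ Y → f i X ≡ g i Y → inflation f i X ≈ₛ inflation g i Y
inflation-cong f g i X≈Y fX≡gY j with j ≟ i
... | yes _ = fX≡gY
... | no  _ = X≈Y j

runSeq-∷ʳ : ∀ (f : Family n) is i X →
  runSeq f (is ∷ʳ i) X ≡ inflation f i (runSeq f is X)
runSeq-∷ʳ f []       i X = refl
runSeq-∷ʳ f (i′ ∷ is) i X = runSeq-∷ʳ f is i (inflation f i′ X)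

inflation-respectsPointwise : (f : Family n) → (∀ i → RespectsPointwise (f i)) →
  ∀ i {X Y} → X ≈ₛ Y → inflation f i X ≈ₛ inflation f i Y
inflation-respectsPointwise f f-resp i X≈Y = inflation-cong f f i X≈Y (f-resp i _ _ X≈Y)

runSeq-respectsPointwise : (f : Family n) → (∀ i → RespectsPointwise (f i)) →
  ∀ is {X Y} → X ≈ₛ Y → runSeq f is X ≈ₛ runSeq f is Y
runSeq-respectsPointwise f f-resp []       X≈Y = X≈Y
runSeq-respectsPointwise f f-resp (i ∷ is) X≈Y =
  runSeq-respectsPointwise f f-resp is (inflation-respectsPointwise f f-resp i X≈Y)

prefixMap-respectsPointwise : (f : Family n) → (∀ i → RespectsPointwise (f i)) →
  ∀ i X Y → X ≈ₛ Y → prefixMap f i X ≈ₛ prefixMap f i Y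
prefixMap-respectsPointwise {n} f f-resp i X Y =
  runSeq-respectsPointwise f f-resp (take (toℕ i) (allFin n))

seqPrefix : Family n → ℕ → State n → State n
seqPrefix {n} f k = runSeq f (take k (allFin n))

seqPrefix-suc : ∀ (f : Family n) {k} (k<n : k < n) X →
  seqPrefix f (suc k) X ≡ inflation f (fromℕ< k<n) (seqPrefix f k X)
seqPrefix-suc {n} f {k} k<n X = begin
  seqPrefix f (suc k) X                               ≡⟨ cong (λ m → seqPrefix f (suc m) X) (sym toℕi≡k) ⟩
  runSeq f (take (suc (toℕ i)) (allFin n)) X          ≡⟨ cong (λ is → runSeq f is X) (take-suc-tabulate id i) ⟩
  runSeq f (take (toℕ i) (allFin n) ∷ʳ i) X           ≡⟨ runSeq-∷ʳ f (take (toℕ i) (allFin n)) i X ⟩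
  inflation f i (seqPrefix f (toℕ i) X)               ≡⟨ cong (λ m → inflation f i (seqPrefix f m X)) toℕi≡k ⟩
  inflation f i (seqPrefix f k X)                     ∎
  where
  open ≡-Reasoning
  i : Fin n
  i = fromℕ< k<n
  toℕi≡k : toℕ i ≡ k
  toℕi≡k = toℕ-fromℕ< k<n

prefixMap-fromℕ< : ∀ (f : Family n) {k} (k<n : k < n) →
  prefixMap f (fromℕ< k<n) ≡ seqPrefix f k
prefixMap-fromℕ< f k<n = cong (seqPrefix f) (toℕ-fromℕ< k<n)

seqPrefix-suc-self : ∀ (f : Family n) {k} (k<n : k < n) X {j} →
  toℕ j ≡ k → seqPrefix f (suc k) X j ≡ f j (seqPrefix f k X)
seqPrefix-suc-self f {k} k<n X {j} toℕj≡k =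
  trans (cong-app (seqPrefix-suc f k<n X) j)
        (subst (λ i → inflation f i (seqPrefix f k X) j ≡ f j (seqPrefix f k X)) j≡i
               (inflation-self f j (seqPrefix f k X)))
  where
  j≡i : j ≡ fromℕ< k<n
  j≡i = toℕ-injective (trans toℕj≡k (sym (toℕ-fromℕ< k<n)))

seqPrefix-suc-other : ∀ (f : Family n) {k} (k<n : k < n) X {j} →
  toℕ j ≢ k → seqPrefix f (suc k) X j ≡ seqPrefix f k X j
seqPrefix-suc-other f {k} k<n X {j} toℕj≢k =
  trans (cong-app (seqPrefix-suc f k<n X) j)
        (inflation-other f (seqPrefix f k X) λ j≡i → toℕj≢k (trans (cong toℕ j≡i) (toℕ-fromℕ< k<n)))

seqPrefix-untouched : ∀ (f : Family n) {k} X {j} →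
  k ≤ℕ n → k ≤ℕ toℕ j → seqPrefix f k X j ≡ X j
seqPrefix-untouched f {zero}  X k≤n k≤j = refl
seqPrefix-untouched f {suc k} X k<n k<j =
  trans (seqPrefix-suc-other f k<n X (λ j≡k → <-irrefl (sym j≡k) k<j))
        (seqPrefix-untouched f X (<⇒≤ k<n) (<⇒≤ k<j))

seqPrefix-settled : ∀ (f : Family n) {k} X {j} →
  k ≤ℕ n → toℕ j < k → seqPrefix f k X j ≡ f j (prefixMap f j X)
seqPrefix-settled f {suc k} X {j} k<n (s≤s j≤k) with toℕ j ℕ.≟ k
... | yes j≡k = trans (seqPrefix-suc-self f k<n X j≡k) (cong (λ m → f j (seqPrefix f m X)) (sym j≡k))
... | no  j≢k = trans (seqPrefix-suc-other f k<n X j≢k) (seqPrefix-settled f X (<⇒≤ k<n) (≤∧≢⇒< j≤k j≢k))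

sdsMap≡seqPrefix : ∀ (f : Family n) X → sdsMap f X ≡ seqPrefix f n X
sdsMap≡seqPrefix {n} f X =
  cong (λ is → runSeq f is X) (sym (take-all n (allFin n) (ℕ.≤-reflexive (length-tabulate id))))

sdsMap-lookup : ∀ (f : Family n) X j → sdsMap f X j ≡ f j (prefixMap f j X)
sdsMap-lookup f X j = trans (cong-app (sdsMap≡seqPrefix f X) j) (seqPrefix-settled f X ≤-refl (toℕ<n j))

prefixMap-lookup-< : ∀ (f : Family n) i X {j} →
  toℕ j < toℕ i → prefixMap f i X j ≡ sdsMap f X j
prefixMap-lookup-< f i X j<i =
  trans (seqPrefix-settled f X (<⇒≤ (toℕ<n i)) j<i) (sym (sdsMap-lookup f X _))

prefixMap-lookup-≥ : ∀ (f : Family n) i X {j} →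
  toℕ i ≤ℕ toℕ j → prefixMap f i X j ≡ X j
prefixMap-lookup-≥ f i X = seqPrefix-untouched f X (<⇒≤ (toℕ<n i))

prefixMap-determinedBy-sdsMap : ∀ (f g : Family n) X →
  sdsMap f X ≈ₛ sdsMap g X → ∀ i → prefixMap f i X ≈ₛ prefixMap g i X
prefixMap-determinedBy-sdsMap f g X same i j with toℕ j <? toℕ i
... | yes j<i = trans (prefixMap-lookup-< f i X j<i) (trans (same j) (sym (prefixMap-lookup-< g i X j<i)))
... | no  j≮i = trans (prefixMap-lookup-≥ f i X (≮⇒≥ j≮i)) (sym (prefixMap-lookup-≥ g i X (≮⇒≥ j≮i)))

sameSdsMap⇒agreeOnImage : ∀ (f g : Family n) → (∀ i → RespectsPointwise (g i)) →
  sdsMap f ≗ₛ sdsMap g → ∀ i X → f i (prefixMap f i X) ≡ g i (prefixMap f i X)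
sameSdsMap⇒agreeOnImage f g g-resp same i X = begin
  f i (prefixMap f i X)  ≡⟨ sym (sdsMap-lookup f X i) ⟩
  sdsMap f X i           ≡⟨ same X i ⟩
  sdsMap g X i           ≡⟨ sdsMap-lookup g X i ⟩
  g i (prefixMap g i X)  ≡⟨ g-resp i _ _ (λ j → sym (prefixMap-determinedBy-sdsMap f g X (same X) i j)) ⟩
  g i (prefixMap f i X)  ∎
  where open ≡-Reasoning

seqPrefix-agree : ∀ (f g : Family n) → (∀ i → RespectsPointwise (g i)) →
  (∀ i X → g i (prefixMap f i X) ≡ f i (prefixMap f i X)) →
  ∀ {k} X → k ≤ℕ n → seqPrefix g k X ≈ₛ seqPrefix f k X
seqPrefix-agree f g g-resp agree {zero}  X _   j = refl
seqPrefix-agree {n} f g g-resp agree {suc k} X k<n j = begin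
  seqPrefix g (suc k) X j                ≡⟨ cong-app (seqPrefix-suc g k<n X) j ⟩
  inflation g i (seqPrefix g k X) j      ≡⟨ inflation-cong g f i IH updates-agree j ⟩
  inflation f i (seqPrefix f k X) j      ≡⟨ cong-app (sym (seqPrefix-suc f k<n X)) j ⟩
  seqPrefix f (suc k) X j                ∎
  where
  open ≡-Reasoning
  i : Fin n
  i = fromℕ< k<n
  IH : seqPrefix g k X ≈ₛ seqPrefix f k X
  IH = seqPrefix-agree f g g-resp agree X (<⇒≤ k<n)
  updates-agree : g i (seqPrefix g k X) ≡ f i (seqPrefix f k X)
  updates-agree = trans (g-resp i _ _ IH)
    (subst (λ P → g i (P X) ≡ f i (P X)) (prefixMap-fromℕ< f k<n) (agree i X))

agreeOnImage⇒sameSdsMap : ∀ (f g : Family n) → (∀ i → RespectsPointwise (g i)) →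
  (∀ i X → g i (prefixMap f i X) ≡ f i (prefixMap f i X)) → sdsMap g ≗ₛ sdsMap f
agreeOnImage⇒sameSdsMap {n} f g g-resp agree X j = begin
  sdsMap g X j      ≡⟨ cong-app (sdsMap≡seqPrefix g X) j ⟩
  seqPrefix g n X j ≡⟨ seqPrefix-agree f g g-resp agree X ≤-refl j ⟩
  seqPrefix f n X j ≡⟨ cong-app (sym (sdsMap≡seqPrefix f X)) j ⟩
  sdsMap f X j      ∎
  where open ≡-Reasoning

agreeOnImage⇒monotoneOnImage : {P : State n → State n} {g h : State n → Bool} →
  MonotoneMap h → (∀ X → g (P X) ≡ h (P X)) → MonotoneOnImage P g
agreeOnImage⇒monotoneOnImage {P = P} h-mono agree X Y PX≤PY =
  subst₂ _≤ᵇ_ (sym (agree X)) (sym (agree Y)) (h-mono (P X) (P Y) PX≤PY)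

-- The existential over states is decided by exhaustive search of
-- Subset n = Vec Bool n, read as a state through lookup.
module UpperClosure {n} (P : State n → State n) (g : State n → Bool) where

  Below : State n → Subset n → Set
  Below Y V = P (lookup V) ≤ₛ Y × T (g (P (lookup V)))

  below? : ∀ Y → Dec (Σ (Subset n) (Below Y))
  below? Y = anySubset? λ V → P (lookup V) ≤ₛ? Y ×-dec T? (g (P (lookup V)))

  upperClosure : State n → Bool
  upperClosure Y = does (below? Y)

  upperClosure-monotone : MonotoneMap upperClosure
  upperClosure-monotone Y Y′ Y≤Y′ =
    does-mono (λ (V , PV≤Y , gPV) → V , ≤ₛ-trans PV≤Y Y≤Y′ , gPV) (below? Y) (below? Y′)

  upperClosure-extends : (∀ X Y → X ≈ₛ Y → P X ≈ₛ P Y) → MonotoneOnImage P g →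
    ∀ X → upperClosure (P X) ≡ g (P X)
  upperClosure-extends P-resp g-mono X = ≤-antisym
    (does-mono (λ (V , PV≤PX , gPV) → T-mono (g-mono (lookup V) X PV≤PX) gPV) (below? (P X)) (T? (g (P X))))
    (does-mono (λ gPX → tabulate X , ≈ₛ⇒≤ₛ (P-resp _ _ X′≈X) , T-mono (g-mono X X′ (≈ₛ⇒≤ₛ (P-resp _ _ X≈X′))) gPX)
               (T? (g (P X))) (below? (P X)))
    where
    X′ : State n
    X′ = lookup (tabulate X)
    X′≈X : X′ ≈ₛ X
    X′≈X = lookup∘tabulate X
    X≈X′ : X ≈ₛ X′
    X≈X′ j = sym (X′≈X j)

open UpperClosure

MonotoneSequentialization : Family n → Set
MonotoneSequentialization {n} f′ = Σ (Graph n) λ Ĝ → Σ (LocalFunctions Ĝ) λ f̂ →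
  MonotoneFamily (proj₁ f̂) × (sdsMap (proj₁ f̂) ≗ₛ parallelMap f′)

proposition4p4 :
    (n : ℕ) (G' : Graph n) (f' : LocalFunctions G') →
    MonotoneFamily (proj₁ f') →
    (G : Graph n) (f : LocalFunctions G) →
    sdsMap (proj₁ f) ≗ₛ parallelMap (proj₁ f') →
    (Σ (Graph n) λ Ĝ → Σ (LocalFunctions Ĝ) λ f̂ →
        MonotoneFamily (proj₁ f̂) × (sdsMap (proj₁ f̂) ≗ₛ parallelMap (proj₁ f')))
    ⇔ (∀ i → MonotoneOnImage (prefixMap (proj₁ f) i) (proj₁ f i))
proposition4p4 n G' f' _ G (f , f-local) sequential = mk⇔ necessary sufficient
  where
  f-resp : ∀ i → RespectsPointwise (f i)
  f-resp = local⇒respectsPointwise {G = G} (f , f-local)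

  necessary : MonotoneSequentialization (proj₁ f') → ∀ i → MonotoneOnImage (prefixMap f i) (f i)
  necessary (Ĝ , f̂ , f̂-mono , f̂-sequential) i =
    agreeOnImage⇒monotoneOnImage {g = f i} {h = proj₁ f̂ i} (f̂-mono i)
      (sameSdsMap⇒agreeOnImage f (proj₁ f̂) (local⇒respectsPointwise {G = Ĝ} f̂) same i)
    where
    same : sdsMap f ≗ₛ sdsMap (proj₁ f̂)
    same X j = trans (sequential X j) (sym (f̂-sequential X j))

  sufficient : (∀ i → MonotoneOnImage (prefixMap f i) (f i)) → MonotoneSequentialization (proj₁ f')
  sufficient f-monoOnImage =
    completeGraph n , respectsPointwise⇒localOnComplete f̂ f̂-resp , f̂-mono ,
    λ X j → trans (agreeOnImage⇒sameSdsMap f f̂ f̂-resp f̂-extends X j) (sequential X j)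
    where
    f̂ : Family n
    f̂ i = upperClosure (prefixMap f i) (f i)
    f̂-mono : MonotoneFamily f̂
    f̂-mono i = upperClosure-monotone (prefixMap f i) (f i)
    f̂-resp : ∀ i → RespectsPointwise (f̂ i)
    f̂-resp i = monotone⇒respectsPointwise (f̂-mono i)
    f̂-extends : ∀ i X → f̂ i (prefixMap f i X) ≡ f i (prefixMap f i X)
    f̂-extends i = upperClosure-extends (prefixMap f i) (f i)
      (prefixMap-respectsPointwise f f-resp i) (f-monoOnImage i)
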